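{- Let $D$ be the derivation on Laurent polynomials in the commuting variables $a,x,z,v,u$ determined by the grammar $$a\to axv,\quad x\to xvz,\quad z\to vz^2,\quad v\to uv^2z,\quad u\to u^2vz$$ (extended by linearity and the Leibniz rule to Laurent polynomials / rational functions in these variables). Then for every $n\ge2$, $$D^{n-2}(av)=\frac{u-1}{xu}D^{n-1}(a)+\frac{v}{u}\Big(1+(n-2)\frac{z}{x}\Big)D^{n-2}(a).$$ -}

module Defs where

open import Data.Nat using (ℕ; zero; suc)
open import Data.Integer as ℤ using (ℤ; +_)
open import Data.Fin using (Fin; zero; suc)
open import Data.Vec using (Vec; []; _∷_; lookup; zipWith; replicate)
open import Data.Vec.Properties using (≡-dec)
open import Data.List using (List; []; _∷_; _++_; map; concatMap)
open import Data.Product using (_×_; _,_)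
open import Relation.Nullary using (yes; no)
open import Relation.Binary.PropositionalEquality using (_≡_)

-- A monomial a^i x^j z^k v^l u^m is its exponent vector (i , j , k , l , m) ∈ ℤ⁵.
Mono : Set
Mono = Vec ℤ 5

_≟ᴹ_ : (m m' : Mono) → Relation.Nullary.Dec (m ≡ m')
_≟ᴹ_ = ≡-dec ℤ._≟_

_·ᴹ_ : Mono → Mono → Mono
_·ᴹ_ = zipWith ℤ._+_

-- A Laurent polynomial is a finite formal sum of terms c·m (c ∈ ℤ, m a monomial).
Laurent : Set
Laurent = List (ℤ × Mono)

coeff : Laurent → Mono → ℤ
coeff [] m = + 0
coeff ((c , m') ∷ p) m with m' ≟ᴹ m
... | yes _ = c ℤ.+ coeff p m
... | no _  = coeff p m

infix 4 _≈_
_≈_ : Laurent → Laurent → Set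
p ≈ q = ∀ m → coeff p m ≡ coeff q m

infixl 6 _+ᴸ_ _-ᴸ_
infixl 7 _*ᴸ_

_+ᴸ_ : Laurent → Laurent → Laurent
_+ᴸ_ = _++_

negᴸ : Laurent → Laurent
negᴸ = map (λ { (c , m) → (ℤ.- c , m) })

_-ᴸ_ : Laurent → Laurent → Laurent
p -ᴸ q = p +ᴸ negᴸ q

_*ᴸ_ : Laurent → Laurent → Laurent
p *ᴸ q = concatMap (λ { (c , m) → map (λ { (d , m') → (c ℤ.* d , m ·ᴹ m') }) q }) p

const : ℤ → Laurent
const c = (c , replicate 5 (+ 0)) ∷ []

single : Fin 5 → ℤ → Mono
single zero e = e ∷ + 0 ∷ + 0 ∷ + 0 ∷ + 0 ∷ []
single (suc zero) e = + 0 ∷ e ∷ + 0 ∷ + 0 ∷ + 0 ∷ []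
single (suc (suc zero)) e = + 0 ∷ + 0 ∷ e ∷ + 0 ∷ + 0 ∷ []
single (suc (suc (suc zero))) e = + 0 ∷ + 0 ∷ + 0 ∷ e ∷ + 0 ∷ []
single (suc (suc (suc (suc zero)))) e = + 0 ∷ + 0 ∷ + 0 ∷ + 0 ∷ e ∷ []

aᴸ xᴸ zᴸ vᴸ uᴸ x⁻¹ u⁻¹ : Laurent
aᴸ = (+ 1 , single zero (+ 1)) ∷ []
xᴸ = (+ 1 , single (suc zero) (+ 1)) ∷ []
zᴸ = (+ 1 , single (suc (suc zero)) (+ 1)) ∷ []
vᴸ = (+ 1 , single (suc (suc (suc zero))) (+ 1)) ∷ []
uᴸ = (+ 1 , single (suc (suc (suc (suc zero)))) (+ 1)) ∷ []
x⁻¹ = (+ 1 , single (suc zero) (ℤ.-[1+ 0 ])) ∷ []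
u⁻¹ = (+ 1 , single (suc (suc (suc (suc zero)))) (ℤ.-[1+ 0 ])) ∷ []

-- Exponent vector of D(y)/y for each variable y, read off from the grammar:
--   D a = a·(x v),  D x = x·(v z),  D z = z·(v z),  D v = v·(u v z),  D u = u·(u v z).
ratio : Fin 5 → Mono
ratio zero                          = + 0 ∷ + 1 ∷ + 0 ∷ + 1 ∷ + 0 ∷ []
ratio (suc zero)                    = + 0 ∷ + 0 ∷ + 1 ∷ + 1 ∷ + 0 ∷ []
ratio (suc (suc zero))              = + 0 ∷ + 0 ∷ + 1 ∷ + 1 ∷ + 0 ∷ []
ratio (suc (suc (suc zero)))        = + 0 ∷ + 0 ∷ + 1 ∷ + 1 ∷ + 1 ∷ []
ratio (suc (suc (suc (suc zero))))  = + 0 ∷ + 0 ∷ + 1 ∷ + 1 ∷ + 1 ∷ []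

allVars : List (Fin 5)
allVars = zero ∷ suc zero ∷ suc (suc zero) ∷ suc (suc (suc zero)) ∷ suc (suc (suc (suc zero))) ∷ []

-- The derivation on a term, by the Leibniz rule:
--   D(c · ∏ y^{e_y}) = Σ_y c · e_y · (∏ y^{e_y}) · (D y / y).
Dterm : ℤ × Mono → Laurent
Dterm (c , m) = map (λ i → (c ℤ.* lookup m i , m ·ᴹ ratio i)) allVars

D : Laurent → Laurent
D = concatMap Dterm

D^ : ℕ → Laurent → Laurent
D^ zero p = p
D^ (suc n) p = D (D^ n p)

-- Write α = (u - 1)/(x u) and β_K = (v/u)(1 + K z/x).  One computes D α = v z/(x u) and
-- D β_K = 0, so D α + β_K = β_(K+1), and the Leibniz rule turns
--   D (α D^(k+1) a + β_k D^k a) = α D^(k+2) a + (D α + β_k) D^(k+1) a + (D β_k) D^k a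
-- into α D^(k+2) a + β_(k+1) D^(k+1) a; the case k = 0 is  a v = α · a x v + (v/u) a.
module Submission where

open import Algebra.Bundles using (AbelianGroup)
import Algebra.Properties.AbelianGroup as AbelianGroupProperties
open import Data.Bool using (if_then_else_)
open import Data.Fin using (Fin)
open import Data.Integer as ℤ using (ℤ; +_)
import Data.Integer.Properties as ℤ
open import Data.Integer.Tactic.RingSolver using (solve-∀)
open import Data.List using (List; []; _∷_; _++_; map; concatMap)
open import Data.List.Properties using (concatMap-++)
open import Data.List.Relation.Unary.All as All using (All)
open import Data.List.Relation.Unary.Any using (here; there)
open import Data.List.Membership.Propositional using (_∉_)
open import Data.List.Membership.Propositional.Properties using (∈-++⁺ˡ; ∈-++⁺ʳ)
open import Data.Nat using (ℕ; zero; suc; _≤_; _∸_; s≤s)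
open import Data.Product using (_×_; _,_; proj₂)
open import Data.Vec using (lookup; replicate)
import Data.Vec as Vec
import Data.Vec.Properties as Vec
open import Function using (_∘_)
open import Relation.Binary.PropositionalEquality
open import Relation.Binary.PropositionalEquality.Algebra using (isMagma)
open import Relation.Nullary using (Dec; yes; no; does; contradiction)
import Relation.Nullary.Decidable as Dec

open import Defs
open import Algebra.Structures {A = Mono} _≡_ using (IsAbelianGroup)
open import Algebra.Properties.CommutativeSemigroup ℤ.+-commutativeSemigroup
  using () renaming (interchange to +-interchange)
open import Algebra.Properties.CommutativeSemigroup ℤ.*-commutativeSemigroup
  using () renaming (x∙yz≈y∙xz to *-leftComm)
open import Data.List.Membership.DecPropositional _≟ᴹ_ using (_∈?_)

1ᴹ : Mono
1ᴹ = replicate 5 (+ 0)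

infix 30 _⁻¹ᴹ
_⁻¹ᴹ : Mono → Mono
_⁻¹ᴹ = Vec.map (ℤ.-_)

·ᴹ-isAbelianGroup : IsAbelianGroup _·ᴹ_ 1ᴹ _⁻¹ᴹ
·ᴹ-isAbelianGroup = record
  { isGroup = record
    { isMonoid = record
      { isSemigroup = record
        { isMagma = isMagma _·ᴹ_
        ; assoc   = Vec.zipWith-assoc ℤ.+-assoc
        }
      ; identity = Vec.zipWith-identityˡ ℤ.+-identityˡ , Vec.zipWith-identityʳ ℤ.+-identityʳ
      }
    ; inverse = Vec.zipWith-inverseˡ ℤ.+-inverseˡ , Vec.zipWith-inverseʳ ℤ.+-inverseʳ
    ; ⁻¹-cong = cong _⁻¹ᴹ
    }
  ; comm = Vec.zipWith-comm ℤ.+-comm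
  }

·ᴹ-abelianGroup : AbelianGroup _ _
·ᴹ-abelianGroup = record { isAbelianGroup = ·ᴹ-isAbelianGroup }

open AbelianGroup ·ᴹ-abelianGroup
  using () renaming (_-_ to _/ᴹ_; comm to ·ᴹ-comm; assoc to ·ᴹ-assoc)
open AbelianGroupProperties ·ᴹ-abelianGroup
  using (x≈z//y; //-rightDividesˡ; ⁻¹-anti-homo-∙)

/ᴹ-·ᴹ : ∀ m a b → m /ᴹ (a ·ᴹ b) ≡ (m /ᴹ b) /ᴹ a
/ᴹ-·ᴹ m a b = trans (cong (m ·ᴹ_) (⁻¹-anti-homo-∙ a b)) (sym (·ᴹ-assoc m (b ⁻¹ᴹ) (a ⁻¹ᴹ)))

/ᴹ-comm : ∀ m a b → (m /ᴹ a) /ᴹ b ≡ (m /ᴹ b) /ᴹ a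
/ᴹ-comm m a b = begin
  (m /ᴹ a) /ᴹ b   ≡⟨ /ᴹ-·ᴹ m b a ⟨
  m /ᴹ (b ·ᴹ a)   ≡⟨ cong (m /ᴹ_) (·ᴹ-comm b a) ⟩
  m /ᴹ (a ·ᴹ b)   ≡⟨ /ᴹ-·ᴹ m a b ⟩
  (m /ᴹ b) /ᴹ a   ∎
  where open ≡-Reasoning

lookup-/ᴹ : ∀ y e i → lookup y i ≡ lookup (y /ᴹ e) i ℤ.+ lookup e i
lookup-/ᴹ y e i =
  trans (cong (λ z → lookup z i) (sym (//-rightDividesˡ e y))) (Vec.lookup-zipWith ℤ._+_ i (y /ᴹ e) e)

private variable A B : Set

∑ : List A → (A → ℤ) → ℤ
∑ []       f = + 0
∑ (x ∷ xs) f = f x ℤ.+ ∑ xs f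

∑-cong : ∀ (xs : List A) {f g} → (∀ x → f x ≡ g x) → ∑ xs f ≡ ∑ xs g
∑-cong []       f≗g = refl
∑-cong (x ∷ xs) f≗g = cong₂ ℤ._+_ (f≗g x) (∑-cong xs f≗g)

∑-zero : ∀ (xs : List A) → ∑ xs (λ _ → + 0) ≡ + 0
∑-zero []       = refl
∑-zero (x ∷ xs) = trans (ℤ.+-identityˡ _) (∑-zero xs)

∑-++ : ∀ (xs ys : List A) f → ∑ (xs ++ ys) f ≡ ∑ xs f ℤ.+ ∑ ys f
∑-++ []       ys f = sym (ℤ.+-identityˡ _)
∑-++ (x ∷ xs) ys f = trans (cong (ℤ._+_ (f x)) (∑-++ xs ys f)) (sym (ℤ.+-assoc (f x) _ _))

∑-+ : ∀ (xs : List A) f g → ∑ xs (λ x → f x ℤ.+ g x) ≡ ∑ xs f ℤ.+ ∑ xs g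
∑-+ []       f g = refl
∑-+ (x ∷ xs) f g = trans (cong (ℤ._+_ (f x ℤ.+ g x)) (∑-+ xs f g)) (+-interchange (f x) (g x) _ _)

∑-*ˡ : ∀ c (xs : List A) f → c ℤ.* ∑ xs f ≡ ∑ xs (λ x → c ℤ.* f x)
∑-*ˡ c []       f = ℤ.*-zeroʳ c
∑-*ˡ c (x ∷ xs) f = trans (ℤ.*-distribˡ-+ c (f x) _) (cong (ℤ._+_ (c ℤ.* f x)) (∑-*ˡ c xs f))

∑-swap : ∀ (xs : List A) (ys : List B) (f : A → B → ℤ) →
         ∑ xs (λ x → ∑ ys (f x)) ≡ ∑ ys (λ y → ∑ xs (λ x → f x y))
∑-swap []       ys f = sym (∑-zero ys)
∑-swap (x ∷ xs) ys f =
  trans (cong (ℤ._+_ (∑ ys (f x))) (∑-swap xs ys f)) (sym (∑-+ ys (f x) (λ y → ∑ xs (λ x′ → f x′ y))))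

∑-map : ∀ (h : A → B) xs f → ∑ (map h xs) f ≡ ∑ xs (λ x → f (h x))
∑-map h []       f = refl
∑-map h (x ∷ xs) f = cong (ℤ._+_ (f (h x))) (∑-map h xs f)

∑-concatMap : ∀ (h : A → List B) xs f →
              ∑ (concatMap h xs) f ≡ ∑ xs (λ x → ∑ (h x) f)
∑-concatMap h []       f = refl
∑-concatMap h (x ∷ xs) f =
  trans (∑-++ (h x) (concatMap h xs) f) (cong (ℤ._+_ (∑ (h x) f)) (∑-concatMap h xs f))

δ : Mono → Mono → ℤ
δ e m = if does (e ≟ᴹ m) then + 1 else + 0

δ-cong : ∀ {e m e′ m′} → (e ≡ m → e′ ≡ m′) → (e′ ≡ m′ → e ≡ m) → δ e m ≡ δ e′ m′
δ-cong {e} {m} {e′} {m′} to from with e ≟ᴹ m | e′ ≟ᴹ m′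
... | yes _   | yes _   = refl
... | no  _   | no  _   = refl
... | yes e≡m | no  e′≢m′ = contradiction (to e≡m) e′≢m′
... | no  e≢m | yes e′≡m′ = contradiction (from e′≡m′) e≢m

δ-·ᴹ : ∀ e f m → δ (e ·ᴹ f) m ≡ δ e (m /ᴹ f)
δ-·ᴹ e f m = δ-cong (x≈z//y e f m) (λ e≡m/f → trans (cong (_·ᴹ f) e≡m/f) (//-rightDividesˡ f m))

δ-lookup : ∀ e m i → lookup e i ℤ.* δ e m ≡ lookup m i ℤ.* δ e m
δ-lookup e m i with e ≟ᴹ m
... | yes refl = refl
... | no  _    = trans (ℤ.*-zeroʳ (lookup e i)) (sym (ℤ.*-zeroʳ (lookup m i)))

coeff-∑ : ∀ p m → coeff p m ≡ ∑ p (λ (c , e) → c ℤ.* δ e m)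
coeff-∑ []            m = refl
coeff-∑ ((c , e) ∷ p) m with e ≟ᴹ m
... | yes _ = cong₂ ℤ._+_ (sym (ℤ.*-identityʳ c)) (coeff-∑ p m)
... | no  _ = trans (coeff-∑ p m) (sym (trans (cong₂ ℤ._+_ (ℤ.*-zeroʳ c) refl) (ℤ.+-identityˡ _)))

coeff-++ : ∀ p q m → coeff (p +ᴸ q) m ≡ coeff p m ℤ.+ coeff q m
coeff-++ p q m = begin
  coeff (p ++ q) m                                     ≡⟨ coeff-∑ (p ++ q) m ⟩
  ∑ (p ++ q) (λ (c , e) → c ℤ.* δ e m)                 ≡⟨ ∑-++ p q _ ⟩
  ∑ p (λ (c , e) → c ℤ.* δ e m) ℤ.+ ∑ q (λ (c , e) → c ℤ.* δ e m)
                                                       ≡⟨ cong₂ ℤ._+_ (coeff-∑ p m) (coeff-∑ q m) ⟨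
  coeff p m ℤ.+ coeff q m                              ∎
  where open ≡-Reasoning

-- (p ⊛ g) m is the coefficient of m in p times a series whose coefficients are given by g.
infixr 7 _⊛_
_⊛_ : Laurent → (Mono → ℤ) → Mono → ℤ
(p ⊛ g) m = ∑ p (λ (c , e) → c ℤ.* g (m /ᴹ e))

⊛-cong : ∀ p {g h} → (∀ m → g m ≡ h m) → ∀ m → (p ⊛ g) m ≡ (p ⊛ h) m
⊛-cong p g≗h m = ∑-cong p (λ (c , e) → cong (c ℤ.*_) (g≗h (m /ᴹ e)))

coeff-*ᴸ-∑∑ : ∀ p q m → coeff (p *ᴸ q) m ≡ ∑ p (λ (c , e) → ∑ q (λ (d , f) → c ℤ.* d ℤ.* δ (e ·ᴹ f) m))
coeff-*ᴸ-∑∑ p q m = trans (coeff-∑ (p *ᴸ q) m)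
  (trans (∑-concatMap _ p _) (∑-cong p (λ (c , e) → ∑-map _ q _)))

coeff-*ᴸ : ∀ p q m → coeff (p *ᴸ q) m ≡ (p ⊛ coeff q) m
coeff-*ᴸ p q m = trans (coeff-*ᴸ-∑∑ p q m) (∑-cong p inner)
  where
  inner : ∀ ((c , e) : ℤ × Mono) →
          ∑ q (λ (d , f) → c ℤ.* d ℤ.* δ (e ·ᴹ f) m) ≡ c ℤ.* coeff q (m /ᴹ e)
  inner (c , e) = begin
    ∑ q (λ (d , f) → c ℤ.* d ℤ.* δ (e ·ᴹ f) m)     ≡⟨ ∑-cong q (λ (d , f) → trans (ℤ.*-assoc c d _)
                                                        (cong (λ t → c ℤ.* (d ℤ.* t)) (shift f))) ⟩
    ∑ q (λ (d , f) → c ℤ.* (d ℤ.* δ f (m /ᴹ e)))  ≡⟨ ∑-*ˡ c q _ ⟨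
    c ℤ.* ∑ q (λ (d , f) → d ℤ.* δ f (m /ᴹ e))    ≡⟨ cong (c ℤ.*_) (coeff-∑ q (m /ᴹ e)) ⟨
    c ℤ.* coeff q (m /ᴹ e)                        ∎
    where
    open ≡-Reasoning
    shift : ∀ f → δ (e ·ᴹ f) m ≡ δ f (m /ᴹ e)
    shift f = trans (cong (λ t → δ t m) (·ᴹ-comm e f)) (δ-·ᴹ f e m)

∑-D : ∀ p (f : ℤ × Mono → ℤ) →
      ∑ (D p) f ≡ ∑ p (λ (c , e) → ∑ allVars (λ i → f (c ℤ.* lookup e i , e ·ᴹ ratio i)))
∑-D p f = trans (∑-concatMap Dterm p f)
  (∑-cong p λ (c , e) → ∑-map (λ i → c ℤ.* lookup e i , e ·ᴹ ratio i) allVars f)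

-- The coefficient of m in D p: the term of p at m · (y / D y) contributes its y-exponent,
-- for each variable y.
∂ : (Mono → ℤ) → Mono → ℤ
∂ g m = ∑ allVars (λ i → lookup (m /ᴹ ratio i) i ℤ.* g (m /ᴹ ratio i))

∂-cong : ∀ {g h} → (∀ m → g m ≡ h m) → ∀ m → ∂ g m ≡ ∂ h m
∂-cong g≗h m = ∑-cong allVars (λ i → cong (lookup (m /ᴹ ratio i) i ℤ.*_) (g≗h (m /ᴹ ratio i)))

coeff-D : ∀ p m → coeff (D p) m ≡ ∂ (coeff p) m
coeff-D p m = begin
  coeff (D p) m
    ≡⟨ trans (coeff-∑ (D p) m) (∑-D p (λ (c , e) → c ℤ.* δ e m)) ⟩
  ∑ p (λ (c , e) → ∑ allVars (λ i → c ℤ.* lookup e i ℤ.* δ (e ·ᴹ ratio i) m))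
    ≡⟨ ∑-cong p (λ (c , e) → ∑-cong allVars (λ i → term c e i)) ⟩
  ∑ p (λ (c , e) → ∑ allVars (λ i → w i ℤ.* (c ℤ.* δ e (m /ᴹ ratio i))))
    ≡⟨ ∑-swap p allVars (λ (c , e) i → w i ℤ.* (c ℤ.* δ e (m /ᴹ ratio i))) ⟩
  ∑ allVars (λ i → ∑ p (λ (c , e) → w i ℤ.* (c ℤ.* δ e (m /ᴹ ratio i))))
    ≡⟨ ∑-cong allVars (λ i → trans (cong (w i ℤ.*_) (coeff-∑ p (m /ᴹ ratio i))) (∑-*ˡ (w i) p _)) ⟨
  ∂ (coeff p) m
    ∎
  where
  open ≡-Reasoning
  w : Fin 5 → ℤ
  w i = lookup (m /ᴹ ratio i) i
  term : ∀ c e i → c ℤ.* lookup e i ℤ.* δ (e ·ᴹ ratio i) m ≡ w i ℤ.* (c ℤ.* δ e (m /ᴹ ratio i))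
  term c e i = begin
    c ℤ.* lookup e i ℤ.* δ (e ·ᴹ ratio i) m         ≡⟨ cong (c ℤ.* lookup e i ℤ.*_) (δ-·ᴹ e (ratio i) m) ⟩
    c ℤ.* lookup e i ℤ.* δ e (m /ᴹ ratio i)         ≡⟨ ℤ.*-assoc c _ _ ⟩
    c ℤ.* (lookup e i ℤ.* δ e (m /ᴹ ratio i))       ≡⟨ cong (c ℤ.*_) (δ-lookup e (m /ᴹ ratio i) i) ⟩
    c ℤ.* (w i ℤ.* δ e (m /ᴹ ratio i))              ≡⟨ *-leftComm c (w i) _ ⟩
    w i ℤ.* (c ℤ.* δ e (m /ᴹ ratio i))              ∎

∂-⊛-summand : ∀ c e (g : Mono → ℤ) m r i →
  lookup (m /ᴹ r) i ℤ.* (c ℤ.* g ((m /ᴹ r) /ᴹ e))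
    ≡ c ℤ.* lookup e i ℤ.* g (m /ᴹ (e ·ᴹ r)) ℤ.+ c ℤ.* (lookup ((m /ᴹ e) /ᴹ r) i ℤ.* g ((m /ᴹ e) /ᴹ r))
∂-⊛-summand c e g m r i = begin
  lookup (m /ᴹ r) i ℤ.* (c ℤ.* g X)
    ≡⟨ cong (λ t → t ℤ.* (c ℤ.* g X)) (lookup-/ᴹ (m /ᴹ r) e i) ⟩
  (lookup X i ℤ.+ lookup e i) ℤ.* (c ℤ.* g X)
    ≡⟨ distrib (lookup X i) (lookup e i) c (g X) ⟩
  c ℤ.* lookup e i ℤ.* g X ℤ.+ c ℤ.* (lookup X i ℤ.* g X)
    ≡⟨ cong₂ (λ u v → c ℤ.* lookup e i ℤ.* g u ℤ.+ c ℤ.* (lookup v i ℤ.* g v)) (/ᴹ-·ᴹ m e r) (/ᴹ-comm m e r) ⟨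
  c ℤ.* lookup e i ℤ.* g (m /ᴹ (e ·ᴹ r)) ℤ.+ c ℤ.* (lookup ((m /ᴹ e) /ᴹ r) i ℤ.* g ((m /ᴹ e) /ᴹ r))
    ∎
  where
  open ≡-Reasoning
  X = (m /ᴹ r) /ᴹ e
  distrib : ∀ x y c z → (x ℤ.+ y) ℤ.* (c ℤ.* z) ≡ c ℤ.* y ℤ.* z ℤ.+ c ℤ.* (x ℤ.* z)
  distrib = solve-∀

∂-⊛ : ∀ p g m → ∂ (p ⊛ g) m ≡ (D p ⊛ g) m ℤ.+ (p ⊛ ∂ g) m
∂-⊛ p g m = begin
  ∂ (p ⊛ g) m
    ≡⟨ ∑-cong allVars (λ i → ∑-*ˡ (w i) p (λ (c , e) → c ℤ.* g ((m /ᴹ ratio i) /ᴹ e))) ⟩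
  ∑ allVars (λ i → ∑ p (λ (c , e) → w i ℤ.* (c ℤ.* g ((m /ᴹ ratio i) /ᴹ e))))
    ≡⟨ ∑-swap allVars p (λ i (c , e) → w i ℤ.* (c ℤ.* g ((m /ᴹ ratio i) /ᴹ e))) ⟩
  ∑ p (λ (c , e) → ∑ allVars (λ i → w i ℤ.* (c ℤ.* g ((m /ᴹ ratio i) /ᴹ e))))
    ≡⟨ ∑-cong p (λ (c , e) → trans (∑-cong allVars (λ i → ∂-⊛-summand c e g m (ratio i) i))
                                    (∑-+ allVars (left c e) (right c e))) ⟩
  ∑ p (λ (c , e) → ∑ allVars (left c e) ℤ.+ ∑ allVars (right c e))
    ≡⟨ ∑-+ p (λ (c , e) → ∑ allVars (left c e)) (λ (c , e) → ∑ allVars (right c e)) ⟩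
  ∑ p (λ (c , e) → ∑ allVars (left c e)) ℤ.+ ∑ p (λ (c , e) → ∑ allVars (right c e))
    ≡⟨ cong₂ ℤ._+_ (∑-D p (λ (c , e) → c ℤ.* g (m /ᴹ e)))
                   (∑-cong p (λ (c , e) → ∑-*ˡ c allVars (λ i → lookup ((m /ᴹ e) /ᴹ ratio i) i ℤ.* g ((m /ᴹ e) /ᴹ ratio i)))) ⟨
  (D p ⊛ g) m ℤ.+ (p ⊛ ∂ g) m
    ∎
  where
  open ≡-Reasoning
  w : Fin 5 → ℤ
  w i = lookup (m /ᴹ ratio i) i
  left right : ℤ → Mono → Fin 5 → ℤ
  left c e i = c ℤ.* lookup e i ℤ.* g (m /ᴹ (e ·ᴹ ratio i))
  right c e i = c ℤ.* (lookup ((m /ᴹ e) /ᴹ ratio i) i ℤ.* g ((m /ᴹ e) /ᴹ ratio i))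

D-++ : ∀ p q → D (p +ᴸ q) ≡ D p +ᴸ D q
D-++ = concatMap-++ Dterm

*ᴸ-distribʳ : ∀ r p q → (p +ᴸ q) *ᴸ r ≡ p *ᴸ r +ᴸ q *ᴸ r
*ᴸ-distribʳ r p q = concatMap-++ _ p q

D-cong : ∀ p q → p ≈ q → D p ≈ D q
D-cong p q p≈q m = trans (coeff-D p m) (trans (∂-cong p≈q m) (sym (coeff-D q m)))

*ᴸ-congʳ : ∀ r p q → p ≈ q → r *ᴸ p ≈ r *ᴸ q
*ᴸ-congʳ r p q p≈q m = trans (coeff-*ᴸ r p m) (trans (⊛-cong r p≈q m) (sym (coeff-*ᴸ r q m)))

*ᴸ-comm : ∀ p q → p *ᴸ q ≈ q *ᴸ p
*ᴸ-comm p q m = begin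
  coeff (p *ᴸ q) m
    ≡⟨ coeff-*ᴸ-∑∑ p q m ⟩
  ∑ p (λ (c , e) → ∑ q (λ (d , f) → c ℤ.* d ℤ.* δ (e ·ᴹ f) m))
    ≡⟨ ∑-swap p q (λ (c , e) (d , f) → c ℤ.* d ℤ.* δ (e ·ᴹ f) m) ⟩
  ∑ q (λ (d , f) → ∑ p (λ (c , e) → c ℤ.* d ℤ.* δ (e ·ᴹ f) m))
    ≡⟨ ∑-cong q (λ (d , f) → ∑-cong p (λ (c , e) →
         cong₂ (λ a b → a ℤ.* δ b m) (ℤ.*-comm c d) (·ᴹ-comm e f))) ⟩
  ∑ q (λ (d , f) → ∑ p (λ (c , e) → d ℤ.* c ℤ.* δ (f ·ᴹ e) m))
    ≡⟨ coeff-*ᴸ-∑∑ q p m ⟨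
  coeff (q *ᴸ p) m
    ∎
  where open ≡-Reasoning

*ᴸ-congˡ : ∀ r p q → p ≈ q → p *ᴸ r ≈ q *ᴸ r
*ᴸ-congˡ r p q p≈q m = trans (*ᴸ-comm p r m) (trans (*ᴸ-congʳ r p q p≈q m) (*ᴸ-comm r q m))

D-*ᴸ : ∀ p q → D (p *ᴸ q) ≈ D p *ᴸ q +ᴸ p *ᴸ D q
D-*ᴸ p q m = begin
  coeff (D (p *ᴸ q)) m                       ≡⟨ coeff-D (p *ᴸ q) m ⟩
  ∂ (coeff (p *ᴸ q)) m                       ≡⟨ ∂-cong (coeff-*ᴸ p q) m ⟩
  ∂ (p ⊛ coeff q) m                          ≡⟨ ∂-⊛ p (coeff q) m ⟩
  (D p ⊛ coeff q) m ℤ.+ (p ⊛ ∂ (coeff q)) m  ≡⟨ cong₂ ℤ._+_ (coeff-*ᴸ (D p) q m)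
                                                 (trans (coeff-*ᴸ p (D q) m) (⊛-cong p (coeff-D q) m)) ⟨
  coeff (D p *ᴸ q) m ℤ.+ coeff (p *ᴸ D q) m  ≡⟨ coeff-++ (D p *ᴸ q) (p *ᴸ D q) m ⟨
  coeff (D p *ᴸ q +ᴸ p *ᴸ D q) m             ∎
  where open ≡-Reasoning

infixr 8 _·ᴸ_
_·ᴸ_ : ℤ → Laurent → Laurent
c ·ᴸ p = map (λ (d , e) → c ℤ.* d , e) p

coeff-·ᴸ : ∀ c p m → coeff (c ·ᴸ p) m ≡ c ℤ.* coeff p m
coeff-·ᴸ c p m = begin
  coeff (c ·ᴸ p) m                           ≡⟨ coeff-∑ (c ·ᴸ p) m ⟩
  ∑ (c ·ᴸ p) (λ (d , e) → d ℤ.* δ e m)       ≡⟨ ∑-map _ p _ ⟩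
  ∑ p (λ (d , e) → c ℤ.* d ℤ.* δ e m)        ≡⟨ ∑-cong p (λ (d , e) → ℤ.*-assoc c d (δ e m)) ⟩
  ∑ p (λ (d , e) → c ℤ.* (d ℤ.* δ e m))      ≡⟨ ∑-*ˡ c p _ ⟨
  c ℤ.* ∑ p (λ (d , e) → d ℤ.* δ e m)        ≡⟨ cong (c ℤ.*_) (coeff-∑ p m) ⟨
  c ℤ.* coeff p m                            ∎
  where open ≡-Reasoning

∂-*ˡ : ∀ c (g : Mono → ℤ) m → ∂ (λ y → c ℤ.* g y) m ≡ c ℤ.* ∂ g m
∂-*ˡ c g m = trans (∑-cong allVars (λ i → *-leftComm (lookup (m /ᴹ ratio i) i) c (g (m /ᴹ ratio i))))
  (sym (∑-*ˡ c allVars (λ i → lookup (m /ᴹ ratio i) i ℤ.* g (m /ᴹ ratio i))))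

D-·ᴸ : ∀ c p → D (c ·ᴸ p) ≈ c ·ᴸ D p
D-·ᴸ c p m = begin
  coeff (D (c ·ᴸ p)) m          ≡⟨ coeff-D (c ·ᴸ p) m ⟩
  ∂ (coeff (c ·ᴸ p)) m          ≡⟨ ∂-cong (coeff-·ᴸ c p) m ⟩
  ∂ (λ y → c ℤ.* coeff p y) m   ≡⟨ ∂-*ˡ c (coeff p) m ⟩
  c ℤ.* ∂ (coeff p) m           ≡⟨ cong (c ℤ.*_) (coeff-D p m) ⟨
  c ℤ.* coeff (D p) m           ≡⟨ coeff-·ᴸ c (D p) m ⟨
  coeff (c ·ᴸ D p) m            ∎
  where open ≡-Reasoning

supp : Laurent → List Mono
supp = map proj₂

coeff-∉ : ∀ p {m} → m ∉ supp p → coeff p m ≡ + 0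
coeff-∉ []            m∉ = refl
coeff-∉ ((c , e) ∷ p) {m} m∉ with e ≟ᴹ m
... | yes refl = contradiction (here refl) m∉
... | no  _    = coeff-∉ p (m∉ ∘ there)

≈-from-support : ∀ p q → All (λ e → coeff p e ≡ coeff q e) (supp p ++ supp q) → p ≈ q
≈-from-support p q agree m with m ∈? supp p ++ supp q
... | yes m∈ = All.lookup agree m∈
... | no  m∉ = trans (coeff-∉ p (m∉ ∘ ∈-++⁺ˡ)) (sym (coeff-∉ q (m∉ ∘ ∈-++⁺ʳ (supp p))))

infix 4 _≈?_
_≈?_ : ∀ p q → Dec (p ≈ q)
p ≈? q = Dec.map′ (≈-from-support p q) (λ p≈q → All.tabulate (λ {e} _ → p≈q e))
  (All.all? (λ e → coeff p e ℤ.≟ coeff q e) (supp p ++ supp q))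

α : Laurent
α = (uᴸ -ᴸ const (+ 1)) *ᴸ x⁻¹ *ᴸ u⁻¹

β : ℤ → Laurent
β K = (vᴸ *ᴸ u⁻¹) *ᴸ (const (+ 1) +ᴸ const K *ᴸ zᴸ *ᴸ x⁻¹)

γ : Laurent
γ = vᴸ *ᴸ zᴸ *ᴸ x⁻¹ *ᴸ u⁻¹

Dα≈γ : D α ≈ γ
Dα≈γ = Dec.from-yes (D α ≈? γ)

Dγ≈0 : D γ ≈ []
Dγ≈0 = Dec.from-yes (D γ ≈? [])

Dvu⁻¹≈0 : D (vᴸ *ᴸ u⁻¹) ≈ []
Dvu⁻¹≈0 = Dec.from-yes (D (vᴸ *ᴸ u⁻¹) ≈? [])

av≈αDa+β₀a : aᴸ *ᴸ vᴸ ≈ α *ᴸ D aᴸ +ᴸ β (+ 0) *ᴸ aᴸ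
av≈αDa+β₀a = Dec.from-yes (aᴸ *ᴸ vᴸ ≈? α *ᴸ D aᴸ +ᴸ β (+ 0) *ᴸ aᴸ)

-- Both sides compute to the same two terms, with coefficients 1·((K·1)·1) and K·1 on γ.
β-split : ∀ K → β K ≡ vᴸ *ᴸ u⁻¹ +ᴸ K ·ᴸ γ
β-split K = cong (λ c → (+ 1 , _) ∷ (c , _) ∷ []) (trans (ℤ.*-identityˡ _) (ℤ.*-identityʳ _))

coeff-β : ∀ K m → coeff (β K) m ≡ coeff (vᴸ *ᴸ u⁻¹) m ℤ.+ K ℤ.* coeff γ m
coeff-β K m = begin
  coeff (β K) m                                      ≡⟨ cong (λ p → coeff p m) (β-split K) ⟩
  coeff (vᴸ *ᴸ u⁻¹ +ᴸ K ·ᴸ γ) m                      ≡⟨ coeff-++ (vᴸ *ᴸ u⁻¹) (K ·ᴸ γ) m ⟩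
  coeff (vᴸ *ᴸ u⁻¹) m ℤ.+ coeff (K ·ᴸ γ) m           ≡⟨ cong (ℤ._+_ (coeff (vᴸ *ᴸ u⁻¹) m)) (coeff-·ᴸ K γ m) ⟩
  coeff (vᴸ *ᴸ u⁻¹) m ℤ.+ K ℤ.* coeff γ m            ∎
  where open ≡-Reasoning

Dβ≈0 : ∀ K → D (β K) ≈ []
Dβ≈0 K m = begin
  coeff (D (β K)) m                                  ≡⟨ cong (λ p → coeff (D p) m) (β-split K) ⟩
  coeff (D (vᴸ *ᴸ u⁻¹ +ᴸ K ·ᴸ γ)) m                  ≡⟨ cong (λ p → coeff p m) (D-++ (vᴸ *ᴸ u⁻¹) (K ·ᴸ γ)) ⟩
  coeff (D (vᴸ *ᴸ u⁻¹) +ᴸ D (K ·ᴸ γ)) m              ≡⟨ coeff-++ (D (vᴸ *ᴸ u⁻¹)) (D (K ·ᴸ γ)) m ⟩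
  coeff (D (vᴸ *ᴸ u⁻¹)) m ℤ.+ coeff (D (K ·ᴸ γ)) m   ≡⟨ cong₂ ℤ._+_ (Dvu⁻¹≈0 m) (trans (D-·ᴸ K γ m) (coeff-·ᴸ K (D γ) m)) ⟩
  + 0 ℤ.+ K ℤ.* coeff (D γ) m                        ≡⟨ cong (λ t → + 0 ℤ.+ K ℤ.* t) (Dγ≈0 m) ⟩
  + 0 ℤ.+ K ℤ.* + 0                                  ≡⟨ cong (ℤ._+_ (+ 0)) (ℤ.*-zeroʳ K) ⟩
  + 0                                                ∎
  where open ≡-Reasoning

Dα+β≈β : ∀ K → D α +ᴸ β K ≈ β (+ 1 ℤ.+ K)
Dα+β≈β K m = begin
  coeff (D α +ᴸ β K) m                               ≡⟨ coeff-++ (D α) (β K) m ⟩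
  coeff (D α) m ℤ.+ coeff (β K) m                    ≡⟨ cong₂ ℤ._+_ (Dα≈γ m) (coeff-β K m) ⟩
  coeff γ m ℤ.+ (coeff (vᴸ *ᴸ u⁻¹) m ℤ.+ K ℤ.* coeff γ m)
                                                     ≡⟨ collect (coeff γ m) (coeff (vᴸ *ᴸ u⁻¹) m) K ⟩
  coeff (vᴸ *ᴸ u⁻¹) m ℤ.+ (+ 1 ℤ.+ K) ℤ.* coeff γ m  ≡⟨ coeff-β (+ 1 ℤ.+ K) m ⟨
  coeff (β (+ 1 ℤ.+ K)) m                            ∎
  where
  open ≡-Reasoning
  collect : ∀ g b K → g ℤ.+ (b ℤ.+ K ℤ.* g) ≡ b ℤ.+ (+ 1 ℤ.+ K) ℤ.* g
  collect = solve-∀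

D-αDA+βA : ∀ K A → D (α *ᴸ D A +ᴸ β K *ᴸ A) ≈ α *ᴸ D (D A) +ᴸ β (+ 1 ℤ.+ K) *ᴸ D A
D-αDA+βA K A m = begin
  ⟦ D (α *ᴸ A₁ +ᴸ β K *ᴸ A) ⟧
    ≡⟨ trans (cong ⟦_⟧ (D-++ (α *ᴸ A₁) (β K *ᴸ A))) (coeff-++ (D (α *ᴸ A₁)) (D (β K *ᴸ A)) m) ⟩
  ⟦ D (α *ᴸ A₁) ⟧ ℤ.+ ⟦ D (β K *ᴸ A) ⟧
    ≡⟨ cong₂ ℤ._+_ (trans (D-*ᴸ α A₁ m) (coeff-++ (D α *ᴸ A₁) (α *ᴸ A₂) m))
                   (trans (D-*ᴸ (β K) A m) (coeff-++ (D (β K) *ᴸ A) (β K *ᴸ A₁) m)) ⟩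
  (⟦ D α *ᴸ A₁ ⟧ ℤ.+ ⟦ α *ᴸ A₂ ⟧) ℤ.+ (⟦ D (β K) *ᴸ A ⟧ ℤ.+ ⟦ β K *ᴸ A₁ ⟧)
    ≡⟨ cong (λ t → (⟦ D α *ᴸ A₁ ⟧ ℤ.+ ⟦ α *ᴸ A₂ ⟧) ℤ.+ (t ℤ.+ ⟦ β K *ᴸ A₁ ⟧))
            (*ᴸ-congˡ A (D (β K)) [] (Dβ≈0 K) m) ⟩
  (⟦ D α *ᴸ A₁ ⟧ ℤ.+ ⟦ α *ᴸ A₂ ⟧) ℤ.+ (+ 0 ℤ.+ ⟦ β K *ᴸ A₁ ⟧)
    ≡⟨ rearrange ⟦ D α *ᴸ A₁ ⟧ ⟦ α *ᴸ A₂ ⟧ ⟦ β K *ᴸ A₁ ⟧ ⟩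
  ⟦ α *ᴸ A₂ ⟧ ℤ.+ (⟦ D α *ᴸ A₁ ⟧ ℤ.+ ⟦ β K *ᴸ A₁ ⟧)
    ≡⟨ cong (ℤ._+_ ⟦ α *ᴸ A₂ ⟧)
            (trans (cong ⟦_⟧ (*ᴸ-distribʳ A₁ (D α) (β K))) (coeff-++ (D α *ᴸ A₁) (β K *ᴸ A₁) m)) ⟨
  ⟦ α *ᴸ A₂ ⟧ ℤ.+ ⟦ (D α +ᴸ β K) *ᴸ A₁ ⟧
    ≡⟨ cong (ℤ._+_ ⟦ α *ᴸ A₂ ⟧) (*ᴸ-congˡ A₁ (D α +ᴸ β K) (β (+ 1 ℤ.+ K)) (Dα+β≈β K) m) ⟩
  ⟦ α *ᴸ A₂ ⟧ ℤ.+ ⟦ β (+ 1 ℤ.+ K) *ᴸ A₁ ⟧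
    ≡⟨ coeff-++ (α *ᴸ A₂) (β (+ 1 ℤ.+ K) *ᴸ A₁) m ⟨
  ⟦ α *ᴸ A₂ +ᴸ β (+ 1 ℤ.+ K) *ᴸ A₁ ⟧
    ∎
  where
  open ≡-Reasoning
  ⟦_⟧ : Laurent → ℤ
  ⟦ p ⟧ = coeff p m
  A₁ = D A
  A₂ = D A₁
  rearrange : ∀ a b d → (a ℤ.+ b) ℤ.+ (+ 0 ℤ.+ d) ≡ b ℤ.+ (a ℤ.+ d)
  rearrange = solve-∀

D^-av : ∀ k → D^ k (aᴸ *ᴸ vᴸ) ≈ α *ᴸ D^ (suc k) aᴸ +ᴸ β (+ k) *ᴸ D^ k aᴸ
D^-av zero      = av≈αDa+β₀a
D^-av (suc k) m =
  trans (D-cong (D^ k (aᴸ *ᴸ vᴸ)) (α *ᴸ D^ (suc k) aᴸ +ᴸ β (+ k) *ᴸ D^ k aᴸ) (D^-av k) m)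
        (D-αDA+βA (+ k) (D^ k aᴸ) m)

theorem4p2 : (n : ℕ) → 2 ≤ n →
    D^ (n ∸ 2) (aᴸ *ᴸ vᴸ)
      ≈ ((uᴸ -ᴸ const (+ 1)) *ᴸ x⁻¹ *ᴸ u⁻¹) *ᴸ D^ (n ∸ 1) aᴸ
        +ᴸ (vᴸ *ᴸ u⁻¹) *ᴸ (const (+ 1) +ᴸ const (+ (n ∸ 2)) *ᴸ zᴸ *ᴸ x⁻¹) *ᴸ D^ (n ∸ 2) aᴸ
theorem4p2 (suc (suc k)) (s≤s (s≤s _)) = D^-av k
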